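{- Let $S$ be an $h$-dimensional $\mathbb{F}_q$-subspace of $\mathbb{F}_{q^n}$ such that $1\in S$ and $3\le h\le n-2$. Let $a\in\mathbb{F}_{q^n}\setminus S$, $b\in\mathbb{F}_{q^n}\setminus\mathbb{F}_q$, and $U=(S\times\{0\})\oplus\langle(1,1)\rangle_{\mathbb{F}_q}\oplus\langle(a,b)\rangle_{\mathbb{F}_q}\subseteq\mathbb{F}_{q^n}^2$. Then the set of points of weight $2$ in $L_U$ different from $\langle(1,0)\rangle_{\mathbb{F}_{q^n}}$ is $\{P_s=\langle(-s+a,b)\rangle_{\mathbb{F}_{q^n}} : s\in S\cap(a+bS)\}$, and the size of this set is $|S\cap(a+bS)|$. In particular, $L_U$ is an $h$-club of rank $h+2$ if and only if $a\notin S+bS$.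
   Context: $q$ is a prime power and $n$ a positive integer. For an $\mathbb{F}_q$-subspace $U$ of $\mathbb{F}_{q^n}^2$, $L_U=\{\langle u\rangle_{\mathbb{F}_{q^n}}: u\in U\setminus\{0\}\}\subseteq\mathrm{PG}(1,q^n)$ is an $\mathbb{F}_q$-linear set of rank $\dim_{\mathbb{F}_q}U$; the weight of $P=\langle v\rangle_{\mathbb{F}_{q^n}}$ is $w_{L_U}(P)=\dim_{\mathbb{F}_q}(U\cap\langle v\rangle_{\mathbb{F}_{q^n}})$. An $i$-club of rank $k$ is an $\mathbb{F}_q$-linear set of rank $k$ in which exactly one point has weight $i$ and all other points have weight $1$. For $b\in\mathbb{F}_{q^n}$ and a subspace $S$, $bS=\{bs:s\in S\}$, $a+bS=\{a+bs: s\in S\}$, and $S+bS$ is the sum of subspaces. -}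

module Defs where

open import Level using (Level; _⊔_)
open import Data.Nat as ℕ using (ℕ; zero; suc; _^_)
open import Data.Nat.Primality using (Prime)
open import Data.Fin using (Fin; zero; suc)
open import Data.Product using (Σ; ∃; _×_; _,_)
open import Relation.Binary.PropositionalEquality using (_≡_)
open import Relation.Nullary using (¬_)
open import Data.Unit.Polymorphic using (⊤)
open import Algebra.Bundles using (CommutativeRing)

IsPrimePower : ℕ → Set
IsPrimePower q = Σ ℕ λ p → Σ ℕ λ k → Prime p × (1 ℕ.≤ k) × (q ≡ p ^ k)

module Over {c ℓ : Level} (R : CommutativeRing c ℓ) where
  open CommutativeRing R using (Carrier; _≈_; _+_; _*_; -_; 0#; 1#)

  F : Set c
  F = Carrier

  IsField : Set (c ⊔ ℓ)
  IsField = (¬ (1# ≈ 0#)) × (∀ x → ¬ (x ≈ 0#) → Σ F λ y → x * y ≈ 1#)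

  record IsSubfield (K : F → Set (c ⊔ ℓ)) : Set (c ⊔ ℓ) where
    field
      resp  : ∀ {x y} → x ≈ y → K x → K y
      has0  : K 0#
      has1  : K 1#
      +-cl  : ∀ {x y} → K x → K y → K (x + y)
      neg-cl : ∀ {x} → K x → K (- x)
      *-cl  : ∀ {x y} → K x → K y → K (x * y)
      inv-cl : ∀ {x y} → K x → x * y ≈ 1# → K y

  HasCard : (K : F → Set (c ⊔ ℓ)) → ℕ → Set (c ⊔ ℓ)
  HasCard K q = Σ (Fin q → F) λ e →
      (∀ i → K (e i))
    × (∀ x → K x → Σ (Fin q) λ i → e i ≈ x)
    × (∀ i j → e i ≈ e j → i ≡ j)

  F² : Set c
  F² = F × F

  _≈²_ : F² → F² → Set ℓ
  (x , y) ≈² (x' , y') = (x ≈ x') × (y ≈ y')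

  0² : F²
  0² = (0# , 0#)

  _+²_ : F² → F² → F²
  (x , y) +² (x' , y') = (x + x' , y + y')

  _·²_ : F → F² → F²
  λ' ·² (x , y) = (λ' * x , λ' * y)

  record VecOps : Set (Level.suc (c ⊔ ℓ)) where
    field
      V    : Set c
      _≈V_ : V → V → Set ℓ
      0V   : V
      _+V_ : V → V → V
      _·V_ : F → V → V

  Fops : VecOps
  Fops = record { V = F ; _≈V_ = _≈_ ; 0V = 0# ; _+V_ = _+_ ; _·V_ = _*_ }

  F²ops : VecOps
  F²ops = record { V = F² ; _≈V_ = _≈²_ ; 0V = 0² ; _+V_ = _+²_ ; _·V_ = _·²_ }

  module Lin (K : F → Set (c ⊔ ℓ)) (W : VecOps) where
    open VecOps W

    lincomb : ∀ {d} → (Fin d → F) → (Fin d → V) → V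
    lincomb {zero}  c e = 0V
    lincomb {suc d} c e = (c zero ·V e zero) +V lincomb (λ i → c (suc i)) (λ i → e (suc i))

    KCoeffs : ℕ → Set (c ⊔ ℓ)
    KCoeffs d = Σ (Fin d → F) λ cs → ∀ i → K (cs i)

    LinIndep : ∀ {d} → (Fin d → V) → Set (c ⊔ ℓ)
    LinIndep {d} e = ∀ (cs : Fin d → F) → (∀ i → K (cs i)) →
                     lincomb cs e ≈V 0V → ∀ i → cs i ≈ 0#

    record IsSubspace (W' : V → Set (c ⊔ ℓ)) : Set (c ⊔ ℓ) where
      field
        resp : ∀ {x y} → x ≈V y → W' x → W' y
        has0 : W' 0V
        +-cl : ∀ {x y} → W' x → W' y → W' (x +V y)
        ·-cl : ∀ {λ' x} → K λ' → W' x → W' (λ' ·V x)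

    HasDim : (V → Set (c ⊔ ℓ)) → ℕ → Set (c ⊔ ℓ)
    HasDim W' d = Σ (Fin d → V) λ e →
        (∀ i → W' (e i))
      × LinIndep e
      × (∀ w → W' w → Σ (Fin d → F) λ cs → (∀ i → K (cs i)) × (w ≈V lincomb cs e))

  module Proj (K : F → Set (c ⊔ ℓ)) where
    open Lin K F²ops public

    Span : F² → F² → Set (c ⊔ ℓ)
    Span v w = Σ F λ t → w ≈² (t ·² v)

    SamePoint : F² → F² → Set (c ⊔ ℓ)
    SamePoint v w = Σ F λ t → ¬ (t ≈ 0#) × (w ≈² (t ·² v))

    NonZero² : F² → Set ℓ
    NonZero² v = ¬ (v ≈² 0²)

    WeightIs : (U : F² → Set (c ⊔ ℓ)) → F² → ℕ → Set (c ⊔ ℓ)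
    WeightIs U v d = HasDim (λ w → U w × Span v w) d

    InL : (U : F² → Set (c ⊔ ℓ)) → F² → Set (c ⊔ ℓ)
    InL U v = Σ F² λ u → U u × NonZero² u × Span v u

    IsClub : ℕ → ℕ → (U : F² → Set (c ⊔ ℓ)) → Set (c ⊔ ℓ)
    IsClub i k U = HasDim U k × Σ F² λ P₀ → NonZero² P₀ × WeightIs U P₀ i ×
      (∀ v → NonZero² v → InL U v → ¬ SamePoint P₀ v → WeightIs U v 1)

  DegreeIs : (K : F → Set (c ⊔ ℓ)) → ℕ → Set (c ⊔ ℓ)
  DegreeIs K n = Lin.HasDim K Fops (λ _ → ⊤) n

  Ugen : (K S : F → Set (c ⊔ ℓ)) → F → F → F² → Set (c ⊔ ℓ)
  Ugen K S a b w = Σ F λ s → Σ F λ λ₁ → Σ F λ μ →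
    S s × K λ₁ × K μ × (w ≈² ((s + λ₁ + μ * a) , (λ₁ + μ * b)))

  InSabS : (S : F → Set (c ⊔ ℓ)) → F → F → F → Set (c ⊔ ℓ)
  InSabS S a b s = S s × Σ F λ t → S t × (s ≈ a + b * t)

  InSplusbS : (S : F → Set (c ⊔ ℓ)) → F → F → Set (c ⊔ ℓ)
  InSplusbS S a b = Σ F λ s → Σ F λ t → S s × S t × (a ≈ s + b * t)

  Pt : F → F → F → F²
  Pt a b s = ((- s + a) , b)

-- Write the vectors of U as s (1, 0) + l (1, 1) + m (a, b) with s ∈ S and l, m ∈ K. A point
-- ⟨v⟩ ≠ ⟨(1, 0)⟩ has v₂ ≠ 0, and U ∩ ⟨(1, 0)⟩ = S × {0} since l + m b = 0 forces l = m = 0 when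
-- b ∉ K. If ⟨v⟩ contains a vector of U with m ≠ 0 and one with m = 0, l ≠ 0, then after scaling
-- these coefficients to 1 the proportionality of the two vectors reads a = (l σ − s) − b (σ + 1),
-- exhibiting s* = l σ − s ∈ S ∩ (a + bS) with ⟨v⟩ = P_{s*}. For any two vectors u, w of U on ⟨v⟩,
-- eliminating the (a, b)-component either yields such a pair or shows w ∈ K u. So the points of
-- weight ≥ 2 other than ⟨(1, 0)⟩ are exactly the P_s, each of weight 2 (spanned by (−t, 1) and
-- P_s when s = a + b t), and all other points have weight 1. Since ⟨(1, 0)⟩ has weight h ≥ 2,
-- L_U is an h-club exactly when there is no P_s, i.e. when a ∉ S + bS.

module Submission where

open import Defs
open import Level using (Level; _⊔_)
open import Algebra.Bundles using (CommutativeRing)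
open import Data.Empty using (⊥; ⊥-elim)
open import Data.Fin using (Fin; zero; suc)
import Data.Fin.Properties as Fin
open import Data.Integer as ℤ using (ℤ; +_; -[1+_]; _⊖_)
import Data.Integer.Properties as ℤ
open import Data.Maybe using (Maybe; just; nothing)
open import Data.Nat as ℕ using (ℕ; zero; suc; s≤s)
import Data.Nat.Properties as ℕₚ
open import Data.Product using (Σ; _×_; _,_; proj₁; proj₂)
open import Data.Sum using (_⊎_; inj₁; inj₂; [_,_]′)
open import Function.Base using (id)
open import Function.Bundles using (_⇔_; mk⇔)
open import Relation.Nullary using (¬_; Dec; yes; no)
import Relation.Binary.PropositionalEquality as ≡

-- The ring solver needs a coefficient ring with decidable equality. ℤ maps into every commutative
-- ring by n ↦ n ×ₙ 1#, and with the type-checking-optimised action con (+ 1) evaluates to 1#.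
module IntegerCoefficientSolver {c ℓ} (R : CommutativeRing c ℓ) where
  open CommutativeRing R
  open import Algebra.Properties.Ring ring
    using (-0#≈0#; -‿involutive; -‿distribˡ-*; -‿distribʳ-*; -‿+-comm)
  open import Algebra.Properties.Semiring.Mult.TCOptimised semiring
    using (1+×; ×-homo-+; ×1-homo-*) renaming (_×_ to _×ₙ_)
  open import Algebra.Solver.Ring.AlmostCommutativeRing
  open import Relation.Binary.Reasoning.Setoid setoid

  ⟦_⟧ℤ : ℤ → Carrier
  ⟦ + n ⟧ℤ = n ×ₙ 1#
  ⟦ -[1+ n ] ⟧ℤ = - (suc n ×ₙ 1#)

  ⊖-homo : ∀ m n → ⟦ m ⊖ n ⟧ℤ ≈ m ×ₙ 1# - n ×ₙ 1#
  ⊖-homo m zero = begin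
    m ×ₙ 1#        ≈⟨ +-identityʳ _ ⟨
    m ×ₙ 1# + 0#   ≈⟨ +-congˡ -0#≈0# ⟨
    m ×ₙ 1# - 0#   ∎
  ⊖-homo zero (suc n) = sym (+-identityˡ _)
  ⊖-homo (suc m) (suc n) = begin
    ⟦ suc m ⊖ suc n ⟧ℤ              ≡⟨ ≡.cong ⟦_⟧ℤ (ℤ.[1+m]⊖[1+n]≡m⊖n m n) ⟩
    ⟦ m ⊖ n ⟧ℤ                      ≈⟨ ⊖-homo m n ⟩
    m ×ₙ 1# - n ×ₙ 1#                 ≈⟨ +-congʳ (+-identityˡ _) ⟨
    (0# + m ×ₙ 1#) - n ×ₙ 1#          ≈⟨ +-congʳ (+-congʳ (-‿inverseʳ 1#)) ⟨
    ((1# - 1#) + m ×ₙ 1#) - n ×ₙ 1#   ≈⟨ +-congʳ (+-assoc _ _ _) ⟩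
    (1# + (- 1# + m ×ₙ 1#)) - n ×ₙ 1# ≈⟨ +-congʳ (+-congˡ (+-comm _ _)) ⟩
    (1# + (m ×ₙ 1# - 1#)) - n ×ₙ 1#   ≈⟨ +-congʳ (+-assoc _ _ _) ⟨
    ((1# + m ×ₙ 1#) - 1#) - n ×ₙ 1#   ≈⟨ +-assoc _ _ _ ⟩
    (1# + m ×ₙ 1#) + (- 1# - n ×ₙ 1#) ≈⟨ +-congˡ (-‿+-comm 1# (n ×ₙ 1#)) ⟩
    (1# + m ×ₙ 1#) - (1# + n ×ₙ 1#)   ≈⟨ +-cong (1+× m 1#) (-‿cong (1+× n 1#)) ⟨
    suc m ×ₙ 1# - suc n ×ₙ 1#         ∎

  +-homo : ∀ i j → ⟦ i ℤ.+ j ⟧ℤ ≈ ⟦ i ⟧ℤ + ⟦ j ⟧ℤ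
  +-homo (+ m) (+ n) = ×-homo-+ 1# m n
  +-homo (+ m) -[1+ n ] = ⊖-homo m (suc n)
  +-homo -[1+ m ] (+ n) = trans (⊖-homo n (suc m)) (+-comm _ _)
  +-homo -[1+ m ] -[1+ n ] = begin
    - (suc (suc (m ℕ.+ n)) ×ₙ 1#)     ≡⟨ ≡.cong (λ k → - (suc k ×ₙ 1#)) (ℕₚ.+-suc m n) ⟨
    - ((suc m ℕ.+ suc n) ×ₙ 1#)       ≈⟨ -‿cong (×-homo-+ 1# (suc m) (suc n)) ⟩
    - (suc m ×ₙ 1# + suc n ×ₙ 1#)      ≈⟨ -‿+-comm _ _ ⟨
    - (suc m ×ₙ 1#) - suc n ×ₙ 1#      ∎

  -‿homo : ∀ i → ⟦ ℤ.- i ⟧ℤ ≈ - ⟦ i ⟧ℤ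
  -‿homo (+ zero) = sym -0#≈0#
  -‿homo (+ suc n) = refl
  -‿homo -[1+ n ] = sym (-‿involutive _)

  *-homo-+ : ∀ m j → ⟦ + m ℤ.* j ⟧ℤ ≈ ⟦ + m ⟧ℤ * ⟦ j ⟧ℤ
  *-homo-+ m (+ n) = trans (reflexive (≡.cong ⟦_⟧ℤ (≡.sym (ℤ.pos-* m n)))) (×1-homo-* m n)
  *-homo-+ m -[1+ n ] = begin
    ⟦ + m ℤ.* -[1+ n ] ⟧ℤ          ≡⟨ ≡.cong ⟦_⟧ℤ (ℤ.neg-distribʳ-* (+ m) (+ suc n)) ⟨
    ⟦ ℤ.- (+ m ℤ.* + suc n) ⟧ℤ     ≈⟨ -‿homo (+ m ℤ.* + suc n) ⟩
    - ⟦ + m ℤ.* + suc n ⟧ℤ         ≈⟨ -‿cong (*-homo-+ m (+ suc n)) ⟩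
    - (m ×ₙ 1# * (suc n ×ₙ 1#))      ≈⟨ -‿distribʳ-* _ _ ⟩
    m ×ₙ 1# * - (suc n ×ₙ 1#)        ∎

  *-homo : ∀ i j → ⟦ i ℤ.* j ⟧ℤ ≈ ⟦ i ⟧ℤ * ⟦ j ⟧ℤ
  *-homo (+ m) j = *-homo-+ m j
  *-homo -[1+ m ] j = begin
    ⟦ -[1+ m ] ℤ.* j ⟧ℤ            ≡⟨ ≡.cong ⟦_⟧ℤ (ℤ.neg-distribˡ-* (+ suc m) j) ⟨
    ⟦ ℤ.- (+ suc m ℤ.* j) ⟧ℤ       ≈⟨ -‿homo (+ suc m ℤ.* j) ⟩
    - ⟦ + suc m ℤ.* j ⟧ℤ           ≈⟨ -‿cong (*-homo-+ (suc m) j) ⟩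
    - (suc m ×ₙ 1# * ⟦ j ⟧ℤ)        ≈⟨ -‿distribˡ-* _ _ ⟩
    - (suc m ×ₙ 1#) * ⟦ j ⟧ℤ        ∎

  ℤ-morphism : ℤ.+-*-rawRing -Raw-AlmostCommutative⟶ fromCommutativeRing R
  ℤ-morphism = record
    { ⟦_⟧ = ⟦_⟧ℤ ; +-homo = +-homo ; *-homo = *-homo ; -‿homo = -‿homo
    ; 0-homo = refl ; 1-homo = refl }

  ≟-induced : ∀ i j → Maybe (⟦ i ⟧ℤ ≈ ⟦ j ⟧ℤ)
  ≟-induced i j with i ℤ.≟ j
  ... | yes ≡.refl = just refl
  ... | no _ = nothing

  open import Algebra.Solver.Ring ℤ.+-*-rawRing (fromCommutativeRing R) ℤ-morphism ≟-induced public

module _ {c ℓ} (R : CommutativeRing c ℓ) where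
  open CommutativeRing R
  open Over R

  HasCard⇒≈-decidable : ∀ {K q} → HasCard K q → ∀ {x y} → K x → K y → Dec (x ≈ y)
  HasCard⇒≈-decidable (e , _ , onto , injective) Kx Ky with onto _ Kx | onto _ Ky
  ... | i , eᵢ≈x | j , eⱼ≈y with i Fin.≟ j
  ... | yes ≡.refl = yes (trans (sym eᵢ≈x) eⱼ≈y)
  ... | no i≢j = no λ x≈y → i≢j (injective i j (trans eᵢ≈x (trans x≈y (sym eⱼ≈y))))

module FieldProperties {c ℓ} (R : CommutativeRing c ℓ) (isField : Over.IsField R) where
  open CommutativeRing R
  open import Relation.Binary.Reasoning.Setoid setoid

  1≉0 : 1# ≉ 0#
  1≉0 = proj₁ isField

  infix 10 _⁻¹⟨_⟩
  _⁻¹⟨_⟩ : (x : Carrier) → x ≉ 0# → Carrier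
  x ⁻¹⟨ x≉0 ⟩ = proj₁ (proj₂ isField x x≉0)

  ⁻¹-inverseʳ : ∀ {x} (x≉0 : x ≉ 0#) → x * x ⁻¹⟨ x≉0 ⟩ ≈ 1#
  ⁻¹-inverseʳ {x} x≉0 = proj₂ (proj₂ isField x x≉0)

  ⁻¹-inverseˡ : ∀ {x} (x≉0 : x ≉ 0#) → x ⁻¹⟨ x≉0 ⟩ * x ≈ 1#
  ⁻¹-inverseˡ x≉0 = trans (*-comm _ _) (⁻¹-inverseʳ x≉0)

  x*y≈z⇒y≈x⁻¹*z : ∀ {x y z} (x≉0 : x ≉ 0#) → x * y ≈ z → y ≈ x ⁻¹⟨ x≉0 ⟩ * z
  x*y≈z⇒y≈x⁻¹*z {x} {y} {z} x≉0 xy≈z = begin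
    y                       ≈⟨ *-identityˡ y ⟨
    1# * y                  ≈⟨ *-congʳ (⁻¹-inverseˡ x≉0) ⟨
    (x ⁻¹⟨ x≉0 ⟩ * x) * y   ≈⟨ *-assoc _ x y ⟩
    x ⁻¹⟨ x≉0 ⟩ * (x * y)   ≈⟨ *-congˡ xy≈z ⟩
    x ⁻¹⟨ x≉0 ⟩ * z         ∎

  *-cancelʳ : ∀ {x y z} → z ≉ 0# → x * z ≈ y * z → x ≈ y
  *-cancelʳ {x} {y} {z} z≉0 xz≈yz = begin
    x                     ≈⟨ x*y≈z⇒y≈x⁻¹*z z≉0 (trans (*-comm z x) xz≈yz) ⟩
    z ⁻¹⟨ z≉0 ⟩ * (y * z) ≈⟨ *-congˡ (*-comm y z) ⟩
    z ⁻¹⟨ z≉0 ⟩ * (z * y) ≈⟨ x*y≈z⇒y≈x⁻¹*z z≉0 refl ⟨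
    y                     ∎

  x*y≈0⇒x≈0 : ∀ {x y} → y ≉ 0# → x * y ≈ 0# → x ≈ 0#
  x*y≈0⇒x≈0 y≉0 xy≈0 = *-cancelʳ y≉0 (trans xy≈0 (sym (zeroˡ _)))

  *-≉0 : ∀ {x y} → x ≉ 0# → y ≉ 0# → x * y ≉ 0#
  *-≉0 x≉0 y≉0 xy≈0 = x≉0 (x*y≈0⇒x≈0 y≉0 xy≈0)

  ⁻¹-≉0 : ∀ {x} (x≉0 : x ≉ 0#) → x ⁻¹⟨ x≉0 ⟩ ≉ 0#
  ⁻¹-≉0 {x} x≉0 x⁻¹≈0 = 1≉0 (begin
    1#                 ≈⟨ ⁻¹-inverseʳ x≉0 ⟨
    x * x ⁻¹⟨ x≉0 ⟩    ≈⟨ *-congˡ x⁻¹≈0 ⟩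
    x * 0#             ≈⟨ zeroʳ x ⟩
    0#                 ∎)

module LinearSets {c ℓ} (R : CommutativeRing c ℓ) (isField : Over.IsField R)
  (K : Over.F R → Set (c ⊔ ℓ)) (K-subfield : Over.IsSubfield R K) where
  open CommutativeRing R hiding (zero)
  open Over R
  open Proj K
  open FieldProperties R isField
  open IntegerCoefficientSolver R using (solve; _:=_; _:+_; _:*_; :-_; con)
  open import Algebra.Properties.Ring ring using (-0#≈0#; -‿involutive)
  open import Relation.Binary.Reasoning.Setoid setoid
  module K-sub = IsSubfield K-subfield
  private module Fᴷ = Lin K Fops

  ≈²-refl : ∀ {x} → x ≈² x
  ≈²-refl = refl , refl

  ≈²-sym : ∀ {x y} → x ≈² y → y ≈² x
  ≈²-sym (p , q) = sym p , sym q

  ≈²-trans : ∀ {x y z} → x ≈² y → y ≈² z → x ≈² z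
  ≈²-trans (p , q) (p′ , q′) = trans p p′ , trans q q′

  +²-identityʳ : ∀ x → (x +² 0²) ≈² x
  +²-identityʳ _ = +-identityʳ _ , +-identityʳ _

  ·²-identityˡ : ∀ x → (1# ·² x) ≈² x
  ·²-identityˡ _ = *-identityˡ _ , *-identityˡ _

  K-⁻¹ : ∀ {x} → K x → (x≉0 : x ≉ 0#) → K (x ⁻¹⟨ x≉0 ⟩)
  K-⁻¹ Kx x≉0 = K-sub.inv-cl Kx (⁻¹-inverseʳ x≉0)

  Span-resp : ∀ {v x y} → x ≈² y → Span v x → Span v y
  Span-resp x≈y (t , x≈tv) = t , ≈²-trans (≈²-sym x≈y) x≈tv

  Span-scale : ∀ {v x} k → Span v x → Span v (k ·² x)
  Span-scale k (t , (p , q)) = k * t , (scale p , scale q)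
    where
    scale : ∀ {xᵢ vᵢ} → xᵢ ≈ t * vᵢ → k * xᵢ ≈ (k * t) * vᵢ
    scale xᵢ≈ = trans (*-congˡ xᵢ≈) (sym (*-assoc k t _))

  Span-+ : ∀ {v x y} → Span v x → Span v y → Span v (x +² y)
  Span-+ (t , (p , q)) (t′ , (p′ , q′)) = t + t′ , (add p p′ , add q q′)
    where
    add : ∀ {xᵢ yᵢ vᵢ} → xᵢ ≈ t * vᵢ → yᵢ ≈ t′ * vᵢ → xᵢ + yᵢ ≈ (t + t′) * vᵢ
    add xᵢ≈ yᵢ≈ = trans (+-cong xᵢ≈ yᵢ≈) (sym (distribʳ _ t t′))

  Span-trans : ∀ {v u w} → Span v u → Span u w → Span v w
  Span-trans (t , (p , q)) (τ , (p′ , q′)) = τ * t , (compose p p′ , compose q q′)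
    where
    compose : ∀ {uᵢ wᵢ vᵢ} → uᵢ ≈ t * vᵢ → wᵢ ≈ τ * uᵢ → wᵢ ≈ (τ * t) * vᵢ
    compose uᵢ≈ wᵢ≈ = trans wᵢ≈ (trans (*-congˡ uᵢ≈) (sym (*-assoc τ t _)))

  Span-cross : ∀ {v x y} → Span v x → Span v y → proj₁ x * proj₂ y ≈ proj₂ x * proj₁ y
  Span-cross {v} {x} {y} (t , (p , q)) (t′ , (p′ , q′)) = begin
    proj₁ x * proj₂ y                ≈⟨ *-cong p q′ ⟩
    (t * proj₁ v) * (t′ * proj₂ v)   ≈⟨ solve 4 (λ t t′ v₁ v₂ → (t :* v₁) :* (t′ :* v₂) := (t :* v₂) :* (t′ :* v₁))
                                              refl t t′ (proj₁ v) (proj₂ v) ⟩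
    (t * proj₂ v) * (t′ * proj₁ v)   ≈⟨ *-cong q p′ ⟨
    proj₂ x * proj₁ y                ∎

  Span-second≈0 : ∀ {v x} → proj₂ v ≉ 0# → Span v x → proj₂ x ≈ 0# → x ≈² 0²
  Span-second≈0 v₂≉0 (t , (p , q)) x₂≈0 = trans p (trans (*-congʳ t≈0) (zeroˡ _)) , x₂≈0
    where
    t≈0 : t ≈ 0#
    t≈0 = x*y≈0⇒x≈0 v₂≉0 (trans (sym q) x₂≈0)

  Span-proportional : ∀ {v x y k} → Span v x → Span v y → proj₂ y ≉ 0# →
                      proj₂ x ≈ k * proj₂ y → x ≈² (k ·² y)
  Span-proportional {x = x} {y} {k} sx sy y₂≉0 x₂≈ = *-cancelʳ y₂≉0 (begin
    proj₁ x * proj₂ y         ≈⟨ Span-cross sx sy ⟩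
    proj₂ x * proj₁ y         ≈⟨ *-congʳ x₂≈ ⟩
    (k * proj₂ y) * proj₁ y   ≈⟨ solve 3 (λ k y₁ y₂ → (k :* y₂) :* y₁ := (k :* y₁) :* y₂) refl k (proj₁ y) (proj₂ y) ⟩
    (k * proj₁ y) * proj₂ y   ∎) , x₂≈

  SamePoint-sym : ∀ {u v} → SamePoint u v → SamePoint v u
  SamePoint-sym (r , r≉0 , (p , q)) =
    r ⁻¹⟨ r≉0 ⟩ , ⁻¹-≉0 r≉0 , (x*y≈z⇒y≈x⁻¹*z r≉0 (sym p) , x*y≈z⇒y≈x⁻¹*z r≉0 (sym q))

  SamePoint⇒Span : ∀ {u v} → SamePoint u v → Span u v
  SamePoint⇒Span (r , _ , v≈ru) = r , v≈ru

  SamePoint-trans : ∀ {u v w} → SamePoint u v → SamePoint v w → SamePoint u w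
  SamePoint-trans (r , r≉0 , w≈) (r′ , r′≉0 , w≈′) =
    r′ * r , *-≉0 r′≉0 r≉0 , proj₂ (Span-trans (r , w≈) (r′ , w≈′))

  Span⇒SamePoint : ∀ {v x} → Span v x → proj₂ x ≉ 0# → SamePoint x v
  Span⇒SamePoint (t , (p , q)) x₂≉0 = SamePoint-sym (t , t≉0 , (p , q))
    where
    t≉0 : t ≉ 0#
    t≉0 t≈0 = x₂≉0 (trans q (trans (*-congʳ t≈0) (zeroˡ _)))

  Span-transport : ∀ {u v w} → SamePoint u v → Span u w → Span v w
  Span-transport u~v = Span-trans (SamePoint⇒Span (SamePoint-sym u~v))

  Span-transport⁻ : ∀ {u v w} → SamePoint u v → Span v w → Span u w
  Span-transport⁻ u~v = Span-trans (SamePoint⇒Span u~v)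

  second≉0 : ∀ {v} → NonZero² v → ¬ SamePoint (1# , 0#) v → proj₂ v ≉ 0#
  second≉0 {v} v≢0 v≁[1,0] v₂≈0 =
    v≁[1,0] (proj₁ v , v₁≉0 , (sym (*-identityʳ _) , trans v₂≈0 (sym (zeroʳ _))))
    where
    v₁≉0 : proj₁ v ≉ 0#
    v₁≉0 v₁≈0 = v≢0 (v₁≈0 , v₂≈0)

  Span-K-multiple : ∀ {v x y k₁ k₂} → Span v x → Span v y → proj₂ y ≉ 0# →
                    K k₁ → K k₂ → (k₁≉0 : k₁ ≉ 0#) → k₁ * proj₂ x ≈ k₂ * proj₂ y →
                    Σ F λ k → K k × (x ≈² (k ·² y))
  Span-K-multiple {k₁ = k₁} {k₂} sx sy y₂≉0 Kk₁ Kk₂ k₁≉0 k₁x₂≈k₂y₂ =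
    k₁ ⁻¹⟨ k₁≉0 ⟩ * k₂ , K-sub.*-cl (K-⁻¹ Kk₁ k₁≉0) Kk₂ ,
    Span-proportional sx sy y₂≉0 (trans (x*y≈z⇒y≈x⁻¹*z k₁≉0 k₁x₂≈k₂y₂) (sym (*-assoc _ _ _)))

  Independent₂ : F² → F² → Set (c ⊔ ℓ)
  Independent₂ x y = ∀ k k′ → K k → K k′ → ((k ·² x) +² (k′ ·² y)) ≈² 0² → k ≈ 0# × k′ ≈ 0#

  lincomb-zero : ∀ {d} (cs : Fin d → F) (e : Fin d → F²) → (∀ i → cs i ≈ 0#) → lincomb cs e ≈² 0²
  lincomb-zero {zero} _ _ _ = ≈²-refl
  lincomb-zero {suc d} cs e cs≈0
    with lincomb-zero (λ i → cs (suc i)) (λ i → e (suc i)) (λ i → cs≈0 (suc i))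
  ... | p , q = vanish p , vanish q
    where
    vanish : ∀ {eᵢ rᵢ} → rᵢ ≈ 0# → cs zero * eᵢ + rᵢ ≈ 0#
    vanish rᵢ≈0 = trans (+-cong (trans (*-congʳ (cs≈0 zero)) (zeroˡ _)) rᵢ≈0) (+-identityʳ 0#)

  LinIndep⇒Independent₂ : ∀ {d} {e : Fin (suc (suc d)) → F²} → LinIndep e →
                          Independent₂ (e zero) (e (suc zero))
  LinIndep⇒Independent₂ {d} {e} indep c₀ c₁ Kc₀ Kc₁ (p , q) =
    indep cs Kcs combination zero , indep cs Kcs combination (suc zero)
    where
    cs : Fin (suc (suc d)) → F
    cs zero = c₀
    cs (suc zero) = c₁
    cs (suc (suc _)) = 0#
    Kcs : ∀ i → K (cs i)
    Kcs zero = Kc₀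
    Kcs (suc zero) = Kc₁
    Kcs (suc (suc _)) = K-sub.has0
    rest : lincomb (λ i → cs (suc (suc i))) (λ i → e (suc (suc i))) ≈² 0²
    rest = lincomb-zero (λ i → cs (suc (suc i))) (λ i → e (suc (suc i))) (λ _ → refl)
    absorb : ∀ {x y z} → x + y ≈ 0# → z ≈ 0# → x + (y + z) ≈ 0#
    absorb x+y≈0 z≈0 = trans (sym (+-assoc _ _ _)) (trans (+-cong x+y≈0 z≈0) (+-identityʳ 0#))
    combination : lincomb cs e ≈² 0²
    combination = absorb p (proj₁ rest) , absorb q (proj₂ rest)

  ¬Independent₂-collinear : ∀ {x y g k k′} → K k → K k′ → x ≈² (k ·² g) → y ≈² (k′ ·² g) →
                            ¬ Independent₂ x y
  ¬Independent₂-collinear {x} {y} {g} {k} {k′} Kk Kk′ x≈ y≈ indep =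
    1≉0 (proj₁ (indep 1# 0# K-sub.has1 K-sub.has0 (only-x (proj₁ x≈) , only-x (proj₂ x≈))))
    where
    cancels : ∀ {xᵢ yᵢ gᵢ} → xᵢ ≈ k * gᵢ → yᵢ ≈ k′ * gᵢ → k′ * xᵢ + (- k) * yᵢ ≈ 0#
    cancels {gᵢ = gᵢ} xᵢ≈ yᵢ≈ = trans (+-cong (*-congˡ xᵢ≈) (*-congˡ yᵢ≈))
      (solve 3 (λ k k′ g → k′ :* (k :* g) :+ (:- k) :* (k′ :* g) := con (+ 0)) refl k k′ gᵢ)
    -k≈0 : - k ≈ 0#
    -k≈0 = proj₂ (indep k′ (- k) Kk′ (K-sub.neg-cl Kk)
                   (cancels (proj₁ x≈) (proj₁ y≈) , cancels (proj₂ x≈) (proj₂ y≈)))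
    k≈0 : k ≈ 0#
    k≈0 = trans (sym (-‿involutive k)) (trans (-‿cong -k≈0) -0#≈0#)
    only-x : ∀ {xᵢ yᵢ gᵢ} → xᵢ ≈ k * gᵢ → 1# * xᵢ + 0# * yᵢ ≈ 0#
    only-x {xᵢ} xᵢ≈ = trans (+-cong (trans (*-identityˡ _) xᵢ≈0) (zeroˡ _)) (+-identityʳ 0#)
      where
      xᵢ≈0 : xᵢ ≈ 0#
      xᵢ≈0 = trans xᵢ≈ (trans (*-congʳ k≈0) (zeroˡ _))

  HasDim-cong : ∀ {W W′ : F² → Set (c ⊔ ℓ)} {d} → (∀ {w} → W w → W′ w) → (∀ {w} → W′ w → W w) →
                HasDim W d → HasDim W′ d
  HasDim-cong W⊆W′ W′⊆W (e , e∈W , indep , spans) =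
    e , (λ i → W⊆W′ (e∈W i)) , indep , (λ w w∈W′ → spans w (W′⊆W w∈W′))

  HasDim-1≢2+ : ∀ {W d} → HasDim W 1 → HasDim W (suc (suc d)) → ⊥
  HasDim-1≢2+ (g , _ , _ , spans) (e , e∈W , indep , _)
    with spans (e zero) (e∈W zero) | spans (e (suc zero)) (e∈W (suc zero))
  ... | k , Kk , x≈ | k′ , Kk′ , y≈ =
    ¬Independent₂-collinear (Kk zero) (Kk′ zero)
      (≈²-trans x≈ (+²-identityʳ _)) (≈²-trans y≈ (+²-identityʳ _))
      (LinIndep⇒Independent₂ {e = e} indep)

  lincomb-horizontal : ∀ {d} (cs f : Fin d → F) → lincomb cs (λ i → (f i , 0#)) ≈² (Fᴷ.lincomb cs f , 0#)
  lincomb-horizontal {zero} _ _ = ≈²-refl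
  lincomb-horizontal {suc d} cs f with lincomb-horizontal (λ i → cs (suc i)) (λ i → f (suc i))
  ... | p , q = +-congˡ p , trans (+-cong (zeroʳ _) q) (+-identityʳ 0#)

module Club {c ℓ} (R : CommutativeRing c ℓ) (isField : Over.IsField R)
  (K : Over.F R → Set (c ⊔ ℓ)) (K-subfield : Over.IsSubfield R K)
  (K-≈0? : ∀ {x} → K x → Dec (CommutativeRing._≈_ R x (CommutativeRing.0# R)))
  (S : Over.F R → Set (c ⊔ ℓ)) (S-subspace : Over.Lin.IsSubspace R K (Over.Fops R) S)
  (1∈S : S (CommutativeRing.1# R)) (a b : Over.F R) (b∉K : ¬ K b) where
  open CommutativeRing R hiding (zero)
  open Over R
  open Proj K
  open FieldProperties R isField
  open LinearSets R isField K K-subfield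
  open IntegerCoefficientSolver R using (solve; _:=_; _:+_; _:*_; _:-_; :-_; con)
  open import Algebra.Properties.Ring ring using (-1*x≈-x)
  open import Algebra.Properties.Group +-group using (x≈y⇒x∙y⁻¹≈ε; inverseˡ-unique)
  open import Relation.Binary.Reasoning.Setoid setoid
  private module Fᴷ = Lin K Fops
  module S-sub = Fᴷ.IsSubspace S-subspace

  U : F² → Set (c ⊔ ℓ)
  U = Ugen K S a b

  ugen : F → F → F → F²
  ugen s l m = (s + l + m * a , l + m * b)

  IsPₛ : F² → Set (c ⊔ ℓ)
  IsPₛ v = Σ F λ s → InSabS S a b s × SamePoint (Pt a b s) v

  S-neg : ∀ {x} → S x → S (- x)
  S-neg Sx = S-sub.resp (-1*x≈-x _) (S-sub.·-cl (K-sub.neg-cl K-sub.has1) Sx)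

  S-diff : ∀ {x y} → S x → S y → S (x - y)
  S-diff Sx Sy = S-sub.+-cl Sx (S-neg Sy)

  b≉0 : b ≉ 0#
  b≉0 b≈0 = b∉K (K-sub.resp (sym b≈0) K-sub.has0)

  [1,0]≢0 : NonZero² (1# , 0#)
  [1,0]≢0 (1≈0 , _) = 1≉0 1≈0

  K-independent-of-b : ∀ {k k′} → K k → K k′ → k * b + k′ ≈ 0# → k ≈ 0# × k′ ≈ 0#
  K-independent-of-b {k} {k′} Kk Kk′ kb+k′≈0 with K-≈0? Kk
  ... | yes k≈0 = k≈0 , (begin
    k′           ≈⟨ +-identityˡ k′ ⟨
    0# + k′      ≈⟨ +-congʳ (trans (*-congʳ k≈0) (zeroˡ b)) ⟨
    k * b + k′   ≈⟨ kb+k′≈0 ⟩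
    0#           ∎)
  ... | no k≉0 = ⊥-elim (b∉K (K-sub.resp (sym b≈) (K-sub.*-cl (K-⁻¹ Kk k≉0) (K-sub.neg-cl Kk′))))
    where
    b≈ : b ≈ k ⁻¹⟨ k≉0 ⟩ * - k′
    b≈ = x*y≈z⇒y≈x⁻¹*z k≉0 (inverseˡ-unique _ _ kb+k′≈0)

  ugen-scale : ∀ k s l m → (k ·² ugen s l m) ≈² ugen (k * s) (k * l) (k * m)
  ugen-scale k s l m =
    solve 5 (λ k s l m a → k :* (s :+ l :+ m :* a) := k :* s :+ k :* l :+ (k :* m) :* a) refl k s l m a ,
    solve 4 (λ k l m b → k :* (l :+ m :* b) := k :* l :+ (k :* m) :* b) refl k l m b

  ugen-m≈0 : ∀ {s l m} → m ≈ 0# → ugen s l m ≈² (s + l , l)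
  ugen-m≈0 {m = m} m≈0 = drop a , drop b
    where
    drop : ∀ {x} y → x + m * y ≈ x
    drop y = trans (+-congˡ (trans (*-congʳ m≈0) (zeroˡ y))) (+-identityʳ _)

  ugen-m≈1 : ∀ {s l m} → m ≈ 1# → ugen s l m ≈² (s + l + a , l + b)
  ugen-m≈1 {m = m} m≈1 = +-congˡ (drop a) , +-congˡ (drop b)
    where
    drop : ∀ y → m * y ≈ y
    drop y = trans (*-congʳ m≈1) (*-identityˡ y)

  horizontal∈U : ∀ {x} → S x → U (x , 0#) × Span (1# , 0#) (x , 0#)
  horizontal∈U {x} Sx =
    (x , 0# , 0# , Sx , K-sub.has0 , K-sub.has0 , ≈²-sym (≈²-trans (ugen-m≈0 refl) (+-identityʳ x , refl))) ,
    (x , (sym (*-identityʳ x) , sym (zeroʳ x)))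

  -- Proportionality reads (σ + 1) (l + b) = s + l + a, i.e. a = (l σ − s) − b (σ + 1).
  IsPₛ-from-normalised-pair : ∀ {v σ s l} → S σ → Span v (σ + 1# , 1#) →
                              S s → K l → Span v (s + l + a , l + b) → IsPₛ v
  IsPₛ-from-normalised-pair {v} {σ} {s} {l} Sσ sp Ss Kl sq =
    l * σ - s , (S-diff (S-sub.·-cl Kl Sσ) Ss , - (σ + 1#) , S-neg (S-sub.+-cl Sσ 1∈S) , s*≈) ,
    Span⇒SamePoint (Span-resp (≈²-sym Pₛ≈) (Span-scale b sp)) b≉0
    where
    s*≈ : l * σ - s ≈ a + b * - (σ + 1#)
    s*≈ = begin
      l * σ - s
        ≈⟨ solve 5 (λ σ s l a b → l :* σ :- s :=
                      (a :+ b :* (:- (σ :+ con (+ 1))))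
                      :+ ((σ :+ con (+ 1)) :* (l :+ b) :- con (+ 1) :* (s :+ l :+ a)))
                   refl σ s l a b ⟩
      (a + b * - (σ + 1#)) + ((σ + 1#) * (l + b) - 1# * (s + l + a))
        ≈⟨ +-congˡ (x≈y⇒x∙y⁻¹≈ε (Span-cross sp sq)) ⟩
      (a + b * - (σ + 1#)) + 0#
        ≈⟨ +-identityʳ _ ⟩
      a + b * - (σ + 1#) ∎
    Pₛ≈ : Pt a b (l * σ - s) ≈² (b ·² (σ + 1# , 1#))
    Pₛ≈ = (begin
      - (l * σ - s) + a            ≈⟨ +-congʳ (-‿cong s*≈) ⟩
      - (a + b * - (σ + 1#)) + a   ≈⟨ solve 3 (λ σ a b → :- (a :+ b :* (:- (σ :+ con (+ 1)))) :+ a :=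
                                                          b :* (σ :+ con (+ 1)))
                                            refl σ a b ⟩
      b * (σ + 1#)                 ∎) , sym (*-identityʳ b)

  IsPₛ-from-pair : ∀ {v σ κ s l m} → S σ → K κ → (κ≉0 : κ ≉ 0#) → Span v (σ + κ , κ) →
                   S s → K l → K m → (m≉0 : m ≉ 0#) → Span v (ugen s l m) → IsPₛ v
  IsPₛ-from-pair {σ = σ} {κ} {s} {l} {m} Sσ Kκ κ≉0 sp Ss Kl Km m≉0 sq =
    IsPₛ-from-normalised-pair
      (S-sub.·-cl (K-⁻¹ Kκ κ≉0) Sσ) (Span-resp p-normal (Span-scale κ⁻¹ sp))
      (S-sub.·-cl (K-⁻¹ Km m≉0) Ss) (K-sub.*-cl (K-⁻¹ Km m≉0) Kl)
      (Span-resp (≈²-trans (ugen-scale m⁻¹ s l m) (ugen-m≈1 (⁻¹-inverseˡ m≉0))) (Span-scale m⁻¹ sq))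
    where
    κ⁻¹ m⁻¹ : F
    κ⁻¹ = κ ⁻¹⟨ κ≉0 ⟩
    m⁻¹ = m ⁻¹⟨ m≉0 ⟩
    p-normal : (κ⁻¹ ·² (σ + κ , κ)) ≈² (κ⁻¹ * σ + 1# , 1#)
    p-normal = trans (distribˡ κ⁻¹ σ κ) (+-congˡ (⁻¹-inverseˡ κ≉0)) , ⁻¹-inverseˡ κ≉0

  -- m w − m′ u has no (a, b)-component: either its (1, 1)-coefficient κ is nonzero and it pairs
  -- with u, or w is a K-multiple of u.
  IsPₛ-or-multiple : ∀ {v u w} → proj₂ v ≉ 0# → U u → Span v u → proj₂ u ≉ 0# → U w → Span v w →
                     IsPₛ v ⊎ Σ F λ k → K k × (w ≈² (k ·² u))
  IsPₛ-or-multiple {v} {u} {w} v₂≉0 (s , l , m , Ss , Kl , Km , u≈) su u₂≉0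
                   (s′ , l′ , m′ , Ss′ , Kl′ , Km′ , w≈) sw
    with K-≈0? Km
  ... | no m≉0 = case-κ (K-≈0? Kκ)
    where
    σ κ : F
    σ = m * s′ - m′ * s
    κ = m * l′ - m′ * l
    Kκ : K κ
    Kκ = K-sub.+-cl (K-sub.*-cl Km Kl′) (K-sub.neg-cl (K-sub.*-cl Km′ Kl))
    z≈ : ((m ·² w) +² ((- m′) ·² u)) ≈² (σ + κ , κ)
    z≈ = trans (+-cong (*-congˡ (proj₁ w≈)) (*-congˡ (proj₁ u≈)))
               (solve 7 (λ s l m s′ l′ m′ a → m :* (s′ :+ l′ :+ m′ :* a) :+ (:- m′) :* (s :+ l :+ m :* a) :=
                                             (m :* s′ :- m′ :* s) :+ (m :* l′ :- m′ :* l))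
                      refl s l m s′ l′ m′ a) ,
         trans (+-cong (*-congˡ (proj₂ w≈)) (*-congˡ (proj₂ u≈)))
               (solve 5 (λ l m l′ m′ b → m :* (l′ :+ m′ :* b) :+ (:- m′) :* (l :+ m :* b) := m :* l′ :- m′ :* l)
                      refl l m l′ m′ b)
    case-κ : Dec (κ ≈ 0#) → IsPₛ v ⊎ Σ F λ k → K k × (w ≈² (k ·² u))
    case-κ (no κ≉0) = inj₁ (IsPₛ-from-pair (S-diff (S-sub.·-cl Km Ss′) (S-sub.·-cl Km′ Ss)) Kκ κ≉0
                              (Span-resp z≈ (Span-+ (Span-scale m sw) (Span-scale (- m′) su)))
                              Ss Kl Km m≉0 (Span-resp u≈ su))
    case-κ (yes κ≈0) = inj₂ (Span-K-multiple sw su u₂≉0 Km Km′ m≉0 (begin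
      m * proj₂ w            ≈⟨ inverseˡ-unique _ _ (trans (proj₂ z≈) κ≈0) ⟩
      - ((- m′) * proj₂ u)   ≈⟨ solve 2 (λ m′ u₂ → :- ((:- m′) :* u₂) := m′ :* u₂) refl m′ (proj₂ u) ⟩
      m′ * proj₂ u           ∎))
  ... | yes m≈0 = case-m′ (K-≈0? Km′)
    where
    u≈′ : u ≈² (s + l , l)
    u≈′ = ≈²-trans u≈ (ugen-m≈0 m≈0)
    l≉0 : l ≉ 0#
    l≉0 l≈0 = u₂≉0 (trans (proj₂ u≈′) l≈0)
    case-m′ : Dec (m′ ≈ 0#) → IsPₛ v ⊎ Σ F λ k → K k × (w ≈² (k ·² u))
    case-m′ (no m′≉0) =
      inj₁ (IsPₛ-from-pair Ss Kl l≉0 (Span-resp u≈′ su) Ss′ Kl′ Km′ m′≉0 (Span-resp w≈ sw))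
    case-m′ (yes m′≈0) = inj₂ (Span-K-multiple sw su u₂≉0 Kl Kl′ l≉0 (begin
      l * proj₂ w    ≈⟨ *-congˡ (proj₂ (≈²-trans w≈ (ugen-m≈0 m′≈0))) ⟩
      l * l′         ≈⟨ *-comm l l′ ⟩
      l′ * l         ≈⟨ *-congˡ (proj₂ u≈′) ⟨
      l′ * proj₂ u   ∎))

  weight-two⇒IsPₛ : ∀ {v} → NonZero² v → ¬ SamePoint (1# , 0#) v → WeightIs U v 2 → IsPₛ v
  weight-two⇒IsPₛ {v} v≢0 v≁[1,0] (e , e∈ , indep , _) =
    [ id , (λ (k , Kk , e₁≈ke₀) → ⊥-elim (¬Independent₂-collinear K-sub.has1 Kk e₀≈1e₀ e₁≈ke₀ indep₂)) ]′
      (IsPₛ-or-multiple v₂≉0 (proj₁ (e∈ zero)) (proj₂ (e∈ zero)) e₀₂≉0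
                             (proj₁ (e∈ (suc zero))) (proj₂ (e∈ (suc zero))))
    where
    v₂≉0 : proj₂ v ≉ 0#
    v₂≉0 = second≉0 v≢0 v≁[1,0]
    indep₂ : Independent₂ (e zero) (e (suc zero))
    indep₂ = LinIndep⇒Independent₂ {e = e} indep
    e₀≈1e₀ : e zero ≈² (1# ·² e zero)
    e₀≈1e₀ = ≈²-sym (·²-identityˡ _)
    e₀₂≉0 : proj₂ (e zero) ≉ 0#
    e₀₂≉0 e₀₂≈0 with Span-second≈0 v₂≉0 (proj₂ (e∈ zero)) e₀₂≈0
    ... | p , q = ¬Independent₂-collinear K-sub.has0 K-sub.has1
                    (trans p (sym (zeroˡ _)) , trans q (sym (zeroˡ _))) (≈²-sym (·²-identityˡ _)) indep₂

  Pₛ≈b·[-t,1] : ∀ {s t} → s ≈ a + b * t → Pt a b s ≈² (b ·² (- t , 1#))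
  Pₛ≈b·[-t,1] {s} {t} s≈ =
    trans (+-congʳ (-‿cong s≈)) (solve 3 (λ a b t → :- (a :+ b :* t) :+ a := b :* (:- t)) refl a b t) ,
    sym (*-identityʳ b)

  weight-two-at-[-t,1] : ∀ {s t} → S s → S t → s ≈ a + b * t → WeightIs U (- t , 1#) 2
  weight-two-at-[-t,1] {s} {t} Ss St s≈ = E , E∈ , indep , spans
    where
    E : Fin 2 → F²
    E zero = (- t , 1#)
    E (suc zero) = Pt a b s
    E∈ : ∀ i → U (E i) × Span (- t , 1#) (E i)
    E∈ zero =
      (- t - 1# , 1# , 0# , S-diff (S-neg St) 1∈S , K-sub.has1 , K-sub.has0 ,
        (solve 2 (λ t a → :- t := (:- t :- con (+ 1)) :+ con (+ 1) :+ con (+ 0) :* a) refl t a ,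
         solve 1 (λ b → con (+ 1) := con (+ 1) :+ con (+ 0) :* b) refl b)) ,
      (1# , ≈²-sym (·²-identityˡ _))
    E∈ (suc zero) =
      (- s , 0# , 1# , S-neg Ss , K-sub.has0 , K-sub.has1 ,
        (solve 2 (λ s a → :- s :+ a := :- s :+ con (+ 0) :+ con (+ 1) :* a) refl s a ,
         solve 1 (λ b → b := con (+ 0) :+ con (+ 1) :* b) refl b)) ,
      (b , Pₛ≈b·[-t,1] s≈)
    second-coordinate : ∀ {c₀ c₁} → K c₀ → K c₁ → c₀ * 1# + (c₁ * b + 0#) ≈ 0# → c₁ ≈ 0# × c₀ ≈ 0#
    second-coordinate {c₀} {c₁} Kc₀ Kc₁ second = K-independent-of-b Kc₁ Kc₀
      (trans (solve 3 (λ c₀ c₁ b → c₁ :* b :+ c₀ := c₀ :* con (+ 1) :+ (c₁ :* b :+ con (+ 0))) refl c₀ c₁ b)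
             second)
    indep : LinIndep E
    indep cs Kcs (_ , second) zero = proj₂ (second-coordinate (Kcs zero) (Kcs (suc zero)) second)
    indep cs Kcs (_ , second) (suc zero) = proj₁ (second-coordinate (Kcs zero) (Kcs (suc zero)) second)
    spans : ∀ w → U w × Span (- t , 1#) w → Σ (Fin 2 → F) λ cs → (∀ i → K (cs i)) × (w ≈² lincomb cs E)
    spans w ((σ , l , m , Sσ , Kl , Km , w≈) , sw) = cs , Kcs , ≈²-trans w≈ke₀ (first , second)
      where
      cs : Fin 2 → F
      cs zero = l
      cs (suc zero) = m
      Kcs : ∀ i → K (cs i)
      Kcs zero = Kl
      Kcs (suc zero) = Km
      w≈ke₀ : w ≈² ((l + m * b) ·² (- t , 1#))
      w≈ke₀ = Span-proportional sw (proj₂ (E∈ zero)) 1≉0 (trans (proj₂ w≈) (sym (*-identityʳ _)))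
      first : (l + m * b) * - t ≈ l * - t + (m * (- s + a) + 0#)
      first = begin
        (l + m * b) * - t                ≈⟨ solve 4 (λ l m b t → (l :+ m :* b) :* (:- t) :=
                                                                l :* (:- t) :+ (m :* (b :* (:- t)) :+ con (+ 0)))
                                                     refl l m b t ⟩
        l * - t + (m * (b * - t) + 0#)   ≈⟨ +-congˡ (+-congʳ (*-congˡ (proj₁ (Pₛ≈b·[-t,1] s≈)))) ⟨
        l * - t + (m * (- s + a) + 0#)   ∎
      second : (l + m * b) * 1# ≈ l * 1# + (m * b + 0#)
      second = solve 3 (λ l m b → (l :+ m :* b) :* con (+ 1) := l :* con (+ 1) :+ (m :* b :+ con (+ 0))) refl l m b

  IsPₛ⇒weight-two : ∀ {v} s → InSabS S a b s → SamePoint (Pt a b s) v →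
                    WeightIs U v 2 × ¬ SamePoint (1# , 0#) v
  IsPₛ⇒weight-two s (Ss , t , St , s≈) Pₛ~v@(r′ , r′≉0 , (_ , v₂≈r′b)) =
    HasDim-cong (λ (w∈U , sw) → w∈U , Span-transport Pₛ~v (Span-transport [-t,1]~Pₛ sw))
                (λ (w∈U , sw) → w∈U , Span-transport⁻ [-t,1]~Pₛ (Span-transport⁻ Pₛ~v sw))
                (weight-two-at-[-t,1] Ss St s≈) ,
    λ (r , _ , (_ , v₂≈r0)) → *-≉0 r′≉0 b≉0 (trans (sym v₂≈r′b) (trans v₂≈r0 (zeroʳ r)))
    where
    [-t,1]~Pₛ : SamePoint (- t , 1#) (Pt a b s)
    [-t,1]~Pₛ = b , b≉0 , Pₛ≈b·[-t,1] s≈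

  Pt-injective : ∀ s s′ → InSabS S a b s → InSabS S a b s′ → SamePoint (Pt a b s) (Pt a b s′) → s ≈ s′
  Pt-injective s s′ _ _ (r , _ , (first , second)) = begin
    s                 ≈⟨ solve 2 (λ s a → s := :- (:- s :+ a) :+ a) refl s a ⟩
    - (- s + a) + a   ≈⟨ +-congʳ (-‿cong same) ⟩
    - (- s′ + a) + a  ≈⟨ solve 2 (λ s a → :- (:- s :+ a) :+ a := s) refl s′ a ⟩
    s′                ∎
    where
    r≈1 : r ≈ 1#
    r≈1 = *-cancelʳ b≉0 (trans (sym second) (sym (*-identityˡ b)))
    same : - s + a ≈ - s′ + a
    same = sym (trans first (trans (*-congʳ r≈1) (*-identityˡ _)))

  IsPₛ⇒a∈S+bS : ∀ {v} → IsPₛ v → InSplusbS S a b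
  IsPₛ⇒a∈S+bS (s , (Ss , t , St , s≈) , _) = s , - t , Ss , S-neg St , (begin
    a                       ≈⟨ solve 3 (λ a b t → a := (a :+ b :* t) :+ b :* (:- t)) refl a b t ⟩
    (a + b * t) + b * - t   ≈⟨ +-congʳ s≈ ⟨
    s + b * - t             ∎)

  weight-horizontal : ∀ {h} → Fᴷ.HasDim S h → WeightIs U (1# , 0#) h
  weight-horizontal {h} (f , f∈S , f-indep , f-spans) = g , (λ i → horizontal∈U (f∈S i)) , indep , spans
    where
    g : Fin h → F²
    g i = (f i , 0#)
    indep : LinIndep g
    indep cs Kcs (first , _) = f-indep cs Kcs (trans (sym (proj₁ (lincomb-horizontal cs f))) first)
    spans : ∀ w → U w × Span (1# , 0#) w → Σ (Fin h → F) λ cs → (∀ i → K (cs i)) × (w ≈² lincomb cs g)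
    spans w ((σ , l , m , Sσ , Kl , Km , w≈) , (t , (_ , w₂≈))) with f-spans σ Sσ
    ... | cs , Kcs , σ≈ = cs , Kcs , ≈²-trans w≈horizontal (≈²-sym (lincomb-horizontal cs f))
      where
      w₂≈0 : proj₂ w ≈ 0#
      w₂≈0 = trans w₂≈ (zeroʳ t)
      m,l≈0 : m ≈ 0# × l ≈ 0#
      m,l≈0 = K-independent-of-b Km Kl (trans (+-comm _ _) (trans (sym (proj₂ w≈)) w₂≈0))
      w≈horizontal : w ≈² (Fᴷ.lincomb cs f , 0#)
      w≈horizontal =
        trans (proj₁ (≈²-trans w≈ (ugen-m≈0 (proj₁ m,l≈0))))
              (trans (+-congˡ (proj₂ m,l≈0)) (trans (+-identityʳ σ) σ≈)) ,
        w₂≈0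

  dim-U : ∀ {h} → Fᴷ.HasDim S h → HasDim U (suc (suc h))
  dim-U {h} (f , f∈S , f-indep , f-spans) = B , B∈U , indep , spans
    where
    B : Fin (suc (suc h)) → F²
    B zero = (a , b)
    B (suc zero) = (1# , 1#)
    B (suc (suc i)) = (f i , 0#)
    B∈U : ∀ i → U (B i)
    B∈U zero = 0# , 0# , 1# , S-sub.has0 , K-sub.has0 , K-sub.has1 ,
      (solve 1 (λ a → a := con (+ 0) :+ con (+ 0) :+ con (+ 1) :* a) refl a ,
       solve 1 (λ b → b := con (+ 0) :+ con (+ 1) :* b) refl b)
    B∈U (suc zero) = 0# , 1# , 0# , S-sub.has0 , K-sub.has1 , K-sub.has0 ,
      (solve 1 (λ a → con (+ 1) := con (+ 0) :+ con (+ 1) :+ con (+ 0) :* a) refl a ,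
       solve 1 (λ b → con (+ 1) := con (+ 1) :+ con (+ 0) :* b) refl b)
    B∈U (suc (suc i)) = proj₁ (horizontal∈U (f∈S i))
    indep : LinIndep B
    indep cs Kcs (first , second) = coefficients
      where
      rest : Fin h → F
      rest i = cs (suc (suc i))
      H : lincomb rest (λ i → B (suc (suc i))) ≈² (Fᴷ.lincomb rest f , 0#)
      H = lincomb-horizontal rest f
      c₀,c₁≈0 : cs zero ≈ 0# × cs (suc zero) ≈ 0#
      c₀,c₁≈0 = K-independent-of-b (Kcs zero) (Kcs (suc zero)) (trans (+-congˡ (begin
        cs (suc zero)                                          ≈⟨ +-identityʳ _ ⟨
        cs (suc zero) + 0#                                     ≈⟨ +-cong (*-identityʳ _) (proj₂ H) ⟨
        cs (suc zero) * 1# + proj₂ (lincomb rest (λ i → B (suc (suc i))))  ∎)) second)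
      rest≈0 : Fᴷ.lincomb rest f ≈ 0#
      rest≈0 = begin
        Fᴷ.lincomb rest f
          ≈⟨ solve 2 (λ a L → L := con (+ 0) :* a :+ (con (+ 0) :* con (+ 1) :+ L)) refl a (Fᴷ.lincomb rest f) ⟩
        0# * a + (0# * 1# + Fᴷ.lincomb rest f)
          ≈⟨ +-cong (*-congʳ (proj₁ c₀,c₁≈0)) (+-cong (*-congʳ (proj₂ c₀,c₁≈0)) (proj₁ H)) ⟨
        cs zero * a + (cs (suc zero) * 1# + proj₁ (lincomb rest (λ i → B (suc (suc i)))))
          ≈⟨ first ⟩
        0# ∎
      coefficients : ∀ i → cs i ≈ 0#
      coefficients zero = proj₁ c₀,c₁≈0
      coefficients (suc zero) = proj₂ c₀,c₁≈0
      coefficients (suc (suc i)) = f-indep rest (λ j → Kcs (suc (suc j))) rest≈0 i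
    spans : ∀ w → U w → Σ (Fin (suc (suc h)) → F) λ cs → (∀ i → K (cs i)) × (w ≈² lincomb cs B)
    spans w (σ , l , m , Sσ , Kl , Km , (w₁≈ , w₂≈)) with f-spans σ Sσ
    ... | cσ , Kcσ , σ≈ = cs , Kcs , (first , second)
      where
      cs : Fin (suc (suc h)) → F
      cs zero = m
      cs (suc zero) = l
      cs (suc (suc i)) = cσ i
      Kcs : ∀ i → K (cs i)
      Kcs zero = Km
      Kcs (suc zero) = Kl
      Kcs (suc (suc i)) = Kcσ i
      H : lincomb cσ (λ i → B (suc (suc i))) ≈² (Fᴷ.lincomb cσ f , 0#)
      H = lincomb-horizontal cσ f
      L : F
      L = Fᴷ.lincomb cσ f
      first : proj₁ w ≈ m * a + (l * 1# + proj₁ (lincomb cσ (λ i → B (suc (suc i)))))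
      first = begin
        proj₁ w                  ≈⟨ w₁≈ ⟩
        σ + l + m * a            ≈⟨ +-congʳ (+-congʳ σ≈) ⟩
        L + l + m * a            ≈⟨ solve 4 (λ L l m a → L :+ l :+ m :* a := m :* a :+ (l :* con (+ 1) :+ L))
                                            refl L l m a ⟩
        m * a + (l * 1# + L)     ≈⟨ +-congˡ (+-congˡ (proj₁ H)) ⟨
        m * a + (l * 1# + proj₁ (lincomb cσ (λ i → B (suc (suc i)))))  ∎
      second : proj₂ w ≈ m * b + (l * 1# + proj₂ (lincomb cσ (λ i → B (suc (suc i)))))
      second = begin
        proj₂ w                  ≈⟨ w₂≈ ⟩
        l + m * b                ≈⟨ solve 3 (λ l m b → l :+ m :* b := m :* b :+ (l :* con (+ 1) :+ con (+ 0)))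
                                            refl l m b ⟩
        m * b + (l * 1# + 0#)    ≈⟨ +-congˡ (+-congˡ (proj₂ H)) ⟨
        m * b + (l * 1# + proj₂ (lincomb cσ (λ i → B (suc (suc i)))))  ∎

  weight-one : ¬ InSplusbS S a b → ∀ {v} → NonZero² v → InL U v → ¬ SamePoint (1# , 0#) v → WeightIs U v 1
  weight-one a∉S+bS {v} v≢0 (u , u∈U , u≢0 , su) v≁[1,0] = (λ _ → u) , (λ _ → u∈U , su) , indep , spans
    where
    v₂≉0 : proj₂ v ≉ 0#
    v₂≉0 = second≉0 v≢0 v≁[1,0]
    u₂≉0 : proj₂ u ≉ 0#
    u₂≉0 u₂≈0 = u≢0 (Span-second≈0 v₂≉0 su u₂≈0)
    indep : LinIndep (λ _ → u)
    indep cs _ (_ , second) zero = x*y≈0⇒x≈0 u₂≉0 (trans (sym (+-identityʳ _)) second)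
    spans : ∀ w → U w × Span v w → Σ (Fin 1 → F) λ cs → (∀ i → K (cs i)) × (w ≈² lincomb cs (λ _ → u))
    spans w (w∈U , sw) with IsPₛ-or-multiple v₂≉0 u∈U su u₂≉0 w∈U sw
    ... | inj₁ v-is-Pₛ = ⊥-elim (a∉S+bS (IsPₛ⇒a∈S+bS v-is-Pₛ))
    ... | inj₂ (k , Kk , w≈ku) = (λ _ → k) , (λ _ → Kk) , ≈²-trans w≈ku (≈²-sym (+²-identityʳ _))

  -- P_s has weight 2 and ⟨(1, 0)⟩ weight h ≥ 2, so neither is a point of weight 1, yet they differ.
  club⇒a∉S+bS : ∀ {h k} → 2 ℕ.≤ h → Fᴷ.HasDim S h → IsClub h k U → ¬ InSplusbS S a b
  club⇒a∉S+bS (s≤s (s≤s _)) S-dim (_ , P₀ , _ , _ , weight-one-off-P₀) (s , t , Ss , St , a≈) =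
    P₀≁Pₛ⇒⊥ P₀~Pₛ⇒⊥
    where
    s≈ : s ≈ a + b * - t
    s≈ = begin
      s                       ≈⟨ solve 3 (λ s b t → s := (s :+ b :* t) :+ b :* (:- t)) refl s b t ⟩
      (s + b * t) + b * - t   ≈⟨ +-congʳ a≈ ⟨
      a + b * - t             ∎
    Pₛ : F²
    Pₛ = Pt a b s
    Pₛ-weight : WeightIs U Pₛ 2 × ¬ SamePoint (1# , 0#) Pₛ
    Pₛ-weight = IsPₛ⇒weight-two s (Ss , - t , S-neg St , s≈) (1# , 1≉0 , ≈²-sym (·²-identityˡ _))
    Pₛ≢0 : NonZero² Pₛ
    Pₛ≢0 (_ , b≈0) = b≉0 b≈0
    Pₛ∈L : InL U Pₛ
    Pₛ∈L = Pₛ , (- s , 0# , 1# , S-neg Ss , K-sub.has0 , K-sub.has1 ,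
                  (solve 2 (λ s a → :- s :+ a := :- s :+ con (+ 0) :+ con (+ 1) :* a) refl s a ,
                   solve 1 (λ b → b := con (+ 0) :+ con (+ 1) :* b) refl b)) ,
           Pₛ≢0 , (1# , ≈²-sym (·²-identityˡ _))
    P₀≁Pₛ⇒⊥ : ¬ ¬ SamePoint P₀ Pₛ
    P₀≁Pₛ⇒⊥ P₀≁Pₛ = HasDim-1≢2+ (weight-one-off-P₀ Pₛ Pₛ≢0 Pₛ∈L P₀≁Pₛ) (proj₁ Pₛ-weight)
    P₀~Pₛ⇒⊥ : ¬ SamePoint P₀ Pₛ
    P₀~Pₛ⇒⊥ P₀~Pₛ =
      HasDim-1≢2+ (weight-one-off-P₀ (1# , 0#) [1,0]≢0 [1,0]∈L P₀≁[1,0]) (weight-horizontal S-dim)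
      where
      [1,0]∈L : InL U (1# , 0#)
      [1,0]∈L = (1# , 0#) , proj₁ (horizontal∈U 1∈S) , [1,0]≢0 , proj₂ (horizontal∈U 1∈S)
      P₀≁[1,0] : ¬ SamePoint P₀ (1# , 0#)
      P₀≁[1,0] P₀~[1,0] = proj₂ Pₛ-weight (SamePoint-trans (SamePoint-sym P₀~[1,0]) P₀~Pₛ)

  a∉S+bS⇒club : ∀ {h} → Fᴷ.HasDim S h → ¬ InSplusbS S a b → IsClub h (h ℕ.+ 2) U
  a∉S+bS⇒club {h} S-dim a∉S+bS =
    ≡.subst (HasDim U) (ℕₚ.+-comm 2 h) (dim-U S-dim) , (1# , 0#) , [1,0]≢0 , weight-horizontal S-dim ,
    λ _ v≢0 v∈L v≁[1,0] → weight-one a∉S+bS v≢0 v∈L v≁[1,0]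

open import Data.Nat using (ℕ; _≤_; _+_)

-- Finiteness of K is used only to decide whether elements of K are zero.
theorem3p2 : ∀ {c ℓ : Level} (q n h : ℕ) (R : CommutativeRing c ℓ) →
    let open Over R in
    IsField →
    IsPrimePower q →
    (K : F → Set (c ⊔ ℓ)) → IsSubfield K → HasCard K q → DegreeIs K n →
    (S : F → Set (c ⊔ ℓ)) → Lin.IsSubspace K Fops S → Lin.HasDim K Fops S h →
    S (CommutativeRing.1# R) → 3 ≤ h → h + 2 ≤ n →
    (a b : F) → ¬ S a → ¬ K b →
    let open Proj K in
    let U = Ugen K S a b in
    ((v : F²) → NonZero² v →
       ((WeightIs U v 2 × ¬ SamePoint (CommutativeRing.1# R , CommutativeRing.0# R) v)
        ⇔ Σ F λ s → InSabS S a b s × SamePoint (Pt a b s) v))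
    × ((s s' : F) → InSabS S a b s → InSabS S a b s' →
         SamePoint (Pt a b s) (Pt a b s') → CommutativeRing._≈_ R s s')
    × (IsClub h (h + 2) U ⇔ (¬ InSplusbS S a b))
theorem3p2 q n h R isField _ K K-subfield K-finite _ S S-subspace S-dim 1∈S 3≤h _ a b _ b∉K =
  (λ v v≢0 → mk⇔ (λ (v-weight , v≁[1,0]) → weight-two⇒IsPₛ v≢0 v≁[1,0] v-weight)
                 (λ (s , s∈ , Pₛ~v) → IsPₛ⇒weight-two s s∈ Pₛ~v)) ,
  Pt-injective ,
  mk⇔ (club⇒a∉S+bS (ℕₚ.m+n≤o⇒n≤o 1 3≤h) S-dim) (a∉S+bS⇒club S-dim)
  where
  K-≈0? : ∀ {x} → K x → Dec (CommutativeRing._≈_ R x (CommutativeRing.0# R))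
  K-≈0? Kx = HasCard⇒≈-decidable R K-finite Kx (Over.IsSubfield.has0 K-subfield)
  open Club R isField K K-subfield K-≈0? S S-subspace 1∈S a b b∉K
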